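{- For every $n\ge1$, the Armstrong polynomial satisfies $A_n(1)=T(1^n)$ and $\frac{d}{dq}A_n(q)\big|_{q=1}=T(1^{n+1})$.
   Context: Let $U_n$ be the set of $n\times n$ upper-triangular matrices with nonnegative integer entries. For $A=(a_{i,j})\in U_n$, the $k$-th hook sum is $h_k=(a_{k,k}+\cdots+a_{k,n})-(a_{1,k}+\cdots+a_{k-1,k})$. A Tesler matrix is one with $h_k=1$ for all $1\le k\le n$; $\mathcal{T}(1^n)$ is the set of $n\times n$ Tesler matrices and $T(1^n)=|\mathcal{T}(1^n)|$. The diagonal product of $A$ is $\mathrm{dpro}(A)=\prod_{i=1}^n(a_{ii}+1)$, and the Armstrong polynomial is $A_n(q)=\sum_{A\in\mathcal{T}(1^n)}q^{\mathrm{dpro}(A)}$. -}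

module Defs where

open import Data.Nat using (ℕ; zero; suc; _+_; _*_; _∸_; _^_; _≤ᵇ_; _<ᵇ_; _<_)
open import Data.Bool using (if_then_else_)
open import Data.Fin using (Fin; toℕ)
open import Data.Vec using (Vec; lookup; tabulate; sum; foldr′)
open import Data.Integer using (ℤ; +_; _-_)
open import Data.List as List using (List)
open import Data.Nat.ListAction using () renaming (sum to lsum)
open import Data.List.Membership.Propositional using (_∈_)
open import Data.List.Relation.Unary.Unique.Propositional using (Unique)
open import Data.Product using (_×_)
open import Function.Bundles using (_⇔_)
open import Relation.Binary.PropositionalEquality using (_≡_)

Mat : ℕ → Set
Mat n = Vec (Vec ℕ n) n

entry : {n : ℕ} → Mat n → Fin n → Fin n → ℕ
entry M i j = lookup (lookup M i) j

UpperTri : {n : ℕ} → Mat n → Set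
UpperTri {n} M = (i j : Fin n) → toℕ j < toℕ i → entry M i j ≡ 0


rowPart : {n : ℕ} → Mat n → Fin n → ℕ
rowPart M k = sum (tabulate λ j → if toℕ k ≤ᵇ toℕ j then entry M k j else 0)

colPart : {n : ℕ} → Mat n → Fin n → ℕ
colPart M k = sum (tabulate λ i → if toℕ i <ᵇ toℕ k then entry M i k else 0)

hook : {n : ℕ} → Mat n → Fin n → ℤ
hook M k = + rowPart M k - + colPart M k

Tesler : {n : ℕ} → Mat n → Set
Tesler {n} M = UpperTri M × ((k : Fin n) → hook M k ≡ + 1)

dpro : {n : ℕ} → Mat n → ℕ
dpro M = foldr′ _*_ 1 (tabulate λ i → suc (entry M i i))

-- L is an exact, duplicate-free enumeration of the set 𝒯(1^n);
-- then T(1^n) = length L.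
Enumerates : (n : ℕ) → List (Mat n) → Set
Enumerates n L = Unique L × ((M : Mat n) → (M ∈ L) ⇔ Tesler M)

armstrong : {n : ℕ} → List (Mat n) → ℕ → ℕ
armstrong L q = lsum (List.map (λ M → q ^ dpro M) L)

-- Its formal derivative d/dq A_n(q) = Σ dpro(A) q^{dpro A - 1}, evaluated at q.
-- (dpro A ≥ 1, so the truncated subtraction is exact.)
armstrongDeriv : {n : ℕ} → List (Mat n) → ℕ → ℕ
armstrongDeriv L q = lsum (List.map (λ M → dpro M * q ^ (dpro M ∸ 1)) L)

module Submission where

-- A_n(1) just counts the summands; A_n'(1) = Σ_{A ∈ 𝒯(1^n)} dpro(A), so the second
-- identity says that 𝒯(1^(n+1)) splits into fibres over 𝒯(1^n) of size dpro(A).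
-- The fibre map `collapse` drops the last row and column of B and adds the last
-- column onto the diagonal.  Over A its inverse is `extend A c`, for the ∏(a_ii + 1)
-- vectors c with c_i ≤ a_ii: move c off the diagonal into a new last column and put
-- 1 + Σ c in the new corner.  Collapsing preserves the first n hooks, and the last
-- hook is 1 exactly when the corner is 1 + (sum of the last column).

open import Defs
open import Data.Nat using (ℕ; zero; suc; _+_; _*_; _∸_; _^_; _≤_; _<_; _≤ᵇ_; _<ᵇ_; s≤s; s≤s⁻¹)
open import Data.Nat.Properties
  using (+-identityʳ; +-assoc; +-comm; *-identityʳ; ^-zeroˡ; ≤-refl; <⇒≤; <-irrefl; <-asym; <⇒≱;
         n≤1+n; m≤n+m; m+n∸n≡m; m∸n+n≡m; ≤⇒≤ᵇ; ≤ᵇ⇒≤; <⇒<ᵇ; <ᵇ⇒<)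
open import Data.Bool using (Bool; true; false; T; if_then_else_)
open import Data.Unit using (tt)
open import Data.Fin using (Fin; toℕ; inject₁; fromℕ) renaming (zero to fzero; suc to fsuc; _≟_ to _≟ᶠ_)
open import Data.Fin.Properties using (toℕ-inject₁; toℕ-fromℕ; toℕ<n; suc-injective)
open import Data.Fin.Relation.Unary.Top using (View; view; ‵fromℕ; ‵inject₁; view-inject₁; view-fromℕ)
open import Data.Vec as V using (Vec; []; _∷_; lookup; tabulate; foldr′)
open import Data.Vec.Properties using (lookup∘tabulate; tabulate∘lookup; tabulate-cong; ∷-injective)
open import Data.List as L using (List; length; map; concatMap; upTo; cartesianProductWith)
open import Data.List.Properties using (length-++; length-map; length-upTo)
open import Data.Integer using (+_; _-_; _⊖_)
open import Data.Integer.Properties using ([1+m]⊖[1+n]≡m⊖n; ⊖-≥; m-n≡m⊖n)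
open import Data.Nat.ListAction using () renaming (sum to lsum)
open import Data.List.Membership.Propositional using (_∈_; find; lose)
open import Data.List.Membership.Propositional.Properties
  using (∈-map⁺; ∈-map⁻; ∈-concatMap⁺; ∈-concatMap⁻; ∈-upTo⁺; ∈-upTo⁻;
         ∈-cartesianProductWith⁺; ∈-cartesianProductWith⁻)
open import Data.List.Membership.Propositional.Properties.WithK using (unique∧set⇒bag)
open import Data.List.Relation.Unary.Unique.Propositional using (Unique)
import Data.List.Relation.Unary.Unique.Propositional.Properties as Unique
import Data.List.Relation.Unary.All as All
import Data.List.Relation.Unary.All.Properties as AllP
import Data.List.Relation.Unary.AllPairs as AllPairs
import Data.List.Relation.Unary.AllPairs.Properties as AllPairsP
open import Data.List.Relation.Binary.Disjoint.Propositional using (Disjoint)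
open import Data.List.Relation.Unary.Any using (here)
open import Data.List.Relation.Binary.BagAndSetEquality using (∼bag⇒↭)
open import Data.List.Relation.Binary.Permutation.Propositional.Properties using (↭-length)
open import Data.Product using (_×_; ∃; _,_; proj₁; proj₂)
open import Data.Empty using (⊥-elim)
open import Function using (_∘_)
open import Function.Bundles using (_⇔_; mk⇔; Equivalence)
open import Relation.Nullary using (¬_; yes; no)
open import Relation.Binary.PropositionalEquality

open ≡-Reasoning

private
  variable
    n : ℕ

∑ : (Fin n → ℕ) → ℕ
∑ f = V.sum (tabulate f)

∑-cong : {f g : Fin n → ℕ} → (∀ i → f i ≡ g i) → ∑ f ≡ ∑ g
∑-cong p = cong V.sum (tabulate-cong p)

∑-zero : (f : Fin n → ℕ) → (∀ i → f i ≡ 0) → ∑ f ≡ 0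
∑-zero {zero} f p = refl
∑-zero {suc n} f p = cong₂ _+_ (p fzero) (∑-zero (f ∘ fsuc) (p ∘ fsuc))

∑-init-last : (f : Fin (suc n) → ℕ) → ∑ f ≡ ∑ (f ∘ inject₁) + f (fromℕ n)
∑-init-last {zero} f = +-identityʳ (f fzero)
∑-init-last {suc n} f = trans (cong (_+_ (f fzero)) (∑-init-last (f ∘ fsuc)))
                              (sym (+-assoc (f fzero) _ _))

∑-bump : (f g : Fin n → ℕ) (k : Fin n) (c : ℕ) → g k ≡ f k + c →
         (∀ j → j ≢ k → g j ≡ f j) → ∑ g ≡ ∑ f + c
∑-bump f g fzero c gk others = begin
  g fzero + ∑ (g ∘ fsuc)   ≡⟨ cong₂ _+_ gk (∑-cong λ j → others (fsuc j) λ ()) ⟩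
  f fzero + c + ∑ (f ∘ fsuc) ≡⟨ +-assoc (f fzero) c _ ⟩
  f fzero + (c + ∑ (f ∘ fsuc)) ≡⟨ cong (_+_ (f fzero)) (+-comm c _) ⟩
  f fzero + (∑ (f ∘ fsuc) + c) ≡⟨ +-assoc (f fzero) _ c ⟨
  f fzero + ∑ (f ∘ fsuc) + c ∎
∑-bump f g (fsuc k) c gk others = begin
  g fzero + ∑ (g ∘ fsuc)     ≡⟨ cong₂ _+_ (others fzero λ ())
                                   (∑-bump (f ∘ fsuc) (g ∘ fsuc) k c gk
                                      λ j j≢k → others (fsuc j) (j≢k ∘ suc-injective)) ⟩
  f fzero + (∑ (f ∘ fsuc) + c) ≡⟨ +-assoc (f fzero) _ c ⟨
  f fzero + ∑ (f ∘ fsuc) + c ∎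

guard : Bool → ℕ → ℕ
guard b x = if b then x else 0

guard-T : ∀ {b x} → T b → guard b x ≡ x
guard-T {true} _ = refl

guard-¬T : ∀ {b x} → ¬ T b → guard b x ≡ 0
guard-¬T {true} ¬t = ⊥-elim (¬t tt)
guard-¬T {false} _ = refl

guard-congT : ∀ b {x y} → (T b → x ≡ y) → guard b x ≡ guard b y
guard-congT true p = p tt
guard-congT false p = refl

inject₁<fromℕ : (i : Fin n) → toℕ (inject₁ i) < toℕ (fromℕ n)
inject₁<fromℕ {n} i = subst₂ _<_ (sym (toℕ-inject₁ i)) (sym (toℕ-fromℕ n)) (toℕ<n i)

guard-inject₁ : (_⊲_ : ℕ → ℕ → Bool) (i j : Fin n) {x : ℕ} →
                guard (toℕ (inject₁ i) ⊲ toℕ (inject₁ j)) x ≡ guard (toℕ i ⊲ toℕ j) x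
guard-inject₁ _⊲_ i j = cong₂ guard (cong₂ _⊲_ (toℕ-inject₁ i) (toℕ-inject₁ j)) refl

Lists : {A : Set} → (A → Set) → List A → Set
Lists {A} P L = Unique L × ((x : A) → (x ∈ L) ⇔ P x)

lists-length : {A : Set} {P : A → Set} {L L′ : List A} →
               Lists P L → Lists P L′ → length L ≡ length L′
lists-length (uniqueL , memL) (uniqueL′ , memL′) =
  ↭-length (∼bag⇒↭ (unique∧set⇒bag uniqueL uniqueL′
  λ {x} → mk⇔ (Equivalence.from (memL′ x) ∘ Equivalence.to (memL x))
              (Equivalence.from (memL x) ∘ Equivalence.to (memL′ x))))

-- Enumerating a total set fibre by fibre.
concatMap-lists : {A B : Set} {P : A → Set} {Q : B → Set} (π : B → A) (F : A → List B) →
  (∀ a → Unique (F a)) → (∀ {a b} → b ∈ F a → π b ≡ a) →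
  (∀ {a b} → P a → b ∈ F a → Q b) → (∀ {b} → Q b → b ∈ F (π b)) → (∀ {b} → Q b → P (π b)) →
  ∀ {L} → Lists P L → Lists Q (concatMap F L)
concatMap-lists {Q = Q} π F unique fibre sound complete πP {L} (uniqueL , memL) =
  Unique.concat⁺ (AllP.map⁺ (All.universal unique L))
                 (AllPairsP.map⁺ (AllPairs.map disjoint uniqueL)) ,
  λ b → mk⇔ (to b) (from b)
  where
  disjoint : ∀ {a a′} → a ≢ a′ → Disjoint (F a) (F a′)
  disjoint a≢a′ (b∈a , b∈a′) = a≢a′ (trans (sym (fibre b∈a)) (fibre b∈a′))

  to : ∀ b → b ∈ concatMap F L → Q b
  to b b∈ with a , a∈L , b∈Fa ← find (∈-concatMap⁻ F b∈) =
    sound (Equivalence.to (memL a) a∈L) b∈Fa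

  from : ∀ b → Q b → b ∈ concatMap F L
  from b q = ∈-concatMap⁺ F (lose (Equivalence.from (memL (π b)) (πP q)) (complete q))

Below : (Fin n → ℕ) → Vec ℕ n → Set
Below {n} d c = (i : Fin n) → lookup c i ≤ d i

boxes : (Fin n → ℕ) → List (Vec ℕ n)
boxes {zero} d = L.[ [] ]
boxes {suc n} d = cartesianProductWith _∷_ (upTo (suc (d fzero))) (boxes (d ∘ fsuc))

boxes-lists : (d : Fin n → ℕ) → Lists (Below d) (boxes d)
boxes-lists d = unique d , λ c → mk⇔ (sound d c) (complete d c)
  where
  unique : ∀ {n} (d : Fin n → ℕ) → Unique (boxes d)
  unique {zero} d = All.[] AllPairs.∷ AllPairs.[]
  unique {suc n} d = Unique.cartesianProductWith⁺ _∷_ ∷-injective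
                       (Unique.upTo⁺ (suc (d fzero))) (unique (d ∘ fsuc))

  sound : ∀ {n} (d : Fin n → ℕ) c → c ∈ boxes d → Below d c
  sound {suc n} d c c∈ i
    with x , c′ , x∈ , c′∈ , refl ←
           ∈-cartesianProductWith⁻ _∷_ (upTo (suc (d fzero))) (boxes (d ∘ fsuc)) c∈
       | i
  ... | fzero = s≤s⁻¹ (∈-upTo⁻ x∈)
  ... | fsuc i = sound (d ∘ fsuc) c′ c′∈ i

  complete : ∀ {n} (d : Fin n → ℕ) c → Below d c → c ∈ boxes d
  complete {zero} d [] _ = here refl
  complete {suc n} d (x ∷ c) below =
    ∈-cartesianProductWith⁺ _∷_ (∈-upTo⁺ (s≤s (below fzero)))
                                (complete (d ∘ fsuc) c (below ∘ fsuc))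

length-cartesianProductWith : {A B C : Set} (f : A → B → C) (xs : List A) (ys : List B) →
                              length (cartesianProductWith f xs ys) ≡ length xs * length ys
length-cartesianProductWith f L.[] ys = refl
length-cartesianProductWith f (x L.∷ xs) ys =
  trans (length-++ (map (f x) ys))
        (cong₂ _+_ (length-map (f x) ys) (length-cartesianProductWith f xs ys))

length-boxes : (d : Fin n → ℕ) → length (boxes d) ≡ foldr′ _*_ 1 (tabulate (suc ∘ d))
length-boxes {zero} d = refl
length-boxes {suc n} d =
  trans (length-cartesianProductWith _∷_ (upTo (suc (d fzero))) (boxes (d ∘ fsuc)))
  (cong₂ _*_ (length-upTo (suc (d fzero))) (length-boxes (d ∘ fsuc)))

tab2 : (Fin n → Fin n → ℕ) → Mat n
tab2 a = tabulate λ i → tabulate λ j → a i j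

entry-tab2 : (a : Fin n → Fin n → ℕ) (i j : Fin n) → entry (tab2 a) i j ≡ a i j
entry-tab2 a i j = trans (cong (λ row → lookup row j) (lookup∘tabulate _ i)) (lookup∘tabulate _ j)

vec-ext : {u v : Vec ℕ n} → (∀ i → lookup u i ≡ lookup v i) → u ≡ v
vec-ext {u = u} {v} p = trans (sym (tabulate∘lookup u)) (trans (tabulate-cong p) (tabulate∘lookup v))

mat-ext : {M N : Mat n} → (∀ i j → entry M i j ≡ entry N i j) → M ≡ N
mat-ext {M = M} {N} p =
  trans (sym (tabulate∘lookup M)) (trans (tabulate-cong (vec-ext ∘ p)) (tabulate∘lookup N))

onDiag : (Fin n → ℕ → ℕ) → (Fin n → Fin n → ℕ) → Fin n → Fin n → ℕ
onDiag f a i j with i ≟ᶠ j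
... | yes _ = f i (a i j)
... | no _ = a i j

onDiag-diag : ∀ f a (i : Fin n) → onDiag f a i i ≡ f i (a i i)
onDiag-diag f a i with i ≟ᶠ i
... | yes _ = refl
... | no i≢i = ⊥-elim (i≢i refl)

onDiag-off : ∀ f a {i j : Fin n} → i ≢ j → onDiag f a i j ≡ a i j
onDiag-off f a {i} {j} i≢j with i ≟ᶠ j
... | yes i≡j = ⊥-elim (i≢j i≡j)
... | no _ = refl

onDiag-inverse : ∀ f g (a b : Fin n → Fin n → ℕ) → (∀ i → f i (g i (a i i)) ≡ a i i) →
                 (∀ i j → b i j ≡ onDiag g a i j) → ∀ i j → onDiag f b i j ≡ a i j
onDiag-inverse f g a b undo b≡ i j with i ≟ᶠ j
... | yes refl = trans (cong (f i) (trans (b≡ i i) (onDiag-diag g a i))) (undo i)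
... | no i≢j = trans (b≡ i j) (onDiag-off g a i≢j)

block : Mat (suc n) → Fin n → Fin n → ℕ
block B i j = entry B (inject₁ i) (inject₁ j)

lastEntry : Mat (suc n) → Fin n → ℕ
lastEntry {n} B i = entry B (inject₁ i) (fromℕ n)

lastcol : Mat (suc n) → Vec ℕ n
lastcol B = tabulate (lastEntry B)

corner : Mat (suc n) → ℕ
corner {n} B = entry B (fromℕ n) (fromℕ n)

collapse : Mat (suc n) → Mat n
collapse B = tab2 (onDiag (λ i x → x + lastEntry B i) (block B))

collapse-diag : (B : Mat (suc n)) (i : Fin n) → entry (collapse B) i i ≡ block B i i + lastEntry B i
collapse-diag B i = trans (entry-tab2 _ i i) (onDiag-diag _ (block B) i)

collapse-off : (B : Mat (suc n)) {i j : Fin n} → i ≢ j → entry (collapse B) i j ≡ block B i j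
collapse-off B {i} {j} i≢j = trans (entry-tab2 _ i j) (onDiag-off _ (block B) i≢j)

extendEntry : Mat n → Vec ℕ n → {i j : Fin (suc n)} → View i → View j → ℕ
extendEntry A c (‵inject₁ i) (‵inject₁ j) = onDiag (λ i x → x ∸ lookup c i) (entry A) i j
extendEntry A c (‵inject₁ i) ‵fromℕ = lookup c i
extendEntry A c ‵fromℕ (‵inject₁ j) = 0
extendEntry A c ‵fromℕ ‵fromℕ = suc (V.sum c)

extend : Mat n → Vec ℕ n → Mat (suc n)
extend A c = tab2 λ i j → extendEntry A c (view i) (view j)

extend-entry : (A : Mat n) (c : Vec ℕ n) (i j : Fin (suc n)) →
               entry (extend A c) i j ≡ extendEntry A c (view i) (view j)
extend-entry A c = entry-tab2 (λ i j → extendEntry A c (view i) (view j))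

extend-block : (A : Mat n) (c : Vec ℕ n) (i j : Fin n) →
               block (extend A c) i j ≡ onDiag (λ i x → x ∸ lookup c i) (entry A) i j
extend-block A c i j =
  trans (extend-entry A c (inject₁ i) (inject₁ j))
        (cong₂ (extendEntry A c) (view-inject₁ i) (view-inject₁ j))

extend-lastEntry : (A : Mat n) (c : Vec ℕ n) (i : Fin n) → lastEntry (extend A c) i ≡ lookup c i
extend-lastEntry {n} A c i =
  trans (extend-entry A c (inject₁ i) (fromℕ n))
        (cong₂ (extendEntry A c) (view-inject₁ i) (view-fromℕ n))

extend-lastRow : (A : Mat n) (c : Vec ℕ n) (j : Fin n) →
                 entry (extend A c) (fromℕ n) (inject₁ j) ≡ 0
extend-lastRow {n} A c j =
  trans (extend-entry A c (fromℕ n) (inject₁ j))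
        (cong₂ (extendEntry A c) (view-fromℕ n) (view-inject₁ j))

extend-corner : (A : Mat n) (c : Vec ℕ n) → corner (extend A c) ≡ suc (V.sum c)
extend-corner {n} A c =
  trans (extend-entry A c (fromℕ n) (fromℕ n))
        (cong₂ (extendEntry A c) (view-fromℕ n) (view-fromℕ n))

lastcol-extend : (A : Mat n) (c : Vec ℕ n) → lastcol (extend A c) ≡ c
lastcol-extend A c = vec-ext λ i → trans (lookup∘tabulate _ i) (extend-lastEntry A c i)

-- c fits under A when 0 ≤ c_i ≤ a_ii for every i; this is what `extend A c` needs
-- to keep the entries nonnegative.

diagonal : Mat n → Fin n → ℕ
diagonal A i = entry A i i

Fits : Mat n → Vec ℕ n → Set
Fits A = Below (diagonal A)

lastcol-fits : (B : Mat (suc n)) → Fits (collapse B) (lastcol B)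
lastcol-fits B i = subst₂ _≤_ (sym (lookup∘tabulate _ i)) (sym (collapse-diag B i)) (m≤n+m _ _)

collapse-extend : (A : Mat n) (c : Vec ℕ n) → Fits A c → collapse (extend A c) ≡ A
collapse-extend A c fits = mat-ext λ i j →
  trans (entry-tab2 _ i j)
        (onDiag-inverse _ _ (entry A) (block (extend A c)) undo (extend-block A c) i j)
  where
  undo : ∀ i → entry A i i ∸ lookup c i + lastEntry (extend A c) i ≡ entry A i i
  undo i = trans (cong (_+_ (entry A i i ∸ lookup c i)) (extend-lastEntry A c i)) (m∸n+n≡m (fits i))

extend-collapse : (B : Mat (suc n)) →
                  (∀ j → entry B (fromℕ n) (inject₁ j) ≡ 0) → corner B ≡ suc (V.sum (lastcol B)) →
                  extend (collapse B) (lastcol B) ≡ B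
extend-collapse {n} B lastRow cornerB = mat-ext entries
  where
  c = lastcol B

  undo : ∀ i → block B i i + lastEntry B i ∸ lookup c i ≡ block B i i
  undo i = trans (cong (block B i i + lastEntry B i ∸_) (lookup∘tabulate _ i))
                 (m+n∸n≡m (block B i i) (lastEntry B i))

  entries : ∀ i j → entry (extend (collapse B) c) i j ≡ entry B i j
  entries i j with view i | view j
  ... | ‵inject₁ i | ‵inject₁ j = trans (extend-block (collapse B) c i j)
          (onDiag-inverse _ _ (block B) (entry (collapse B)) undo (entry-tab2 _) i j)
  ... | ‵inject₁ i | ‵fromℕ = trans (extend-lastEntry (collapse B) c i) (lookup∘tabulate _ i)
  ... | ‵fromℕ | ‵inject₁ j = trans (extend-lastRow (collapse B) c j) (sym (lastRow j))
  ... | ‵fromℕ | ‵fromℕ = trans (extend-corner (collapse B) c) (sym cornerB)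

rowPart-collapse : (B : Mat (suc n)) (k : Fin n) → rowPart (collapse B) k ≡ rowPart B (inject₁ k)
rowPart-collapse {n} B k = begin
  ∑ collapsedRow
    ≡⟨ ∑-bump blockRow collapsedRow k (lastEntry B k) onDiagonal offDiagonal ⟩
  ∑ blockRow + lastEntry B k
    ≡⟨ cong₂ _+_ (∑-cong λ j → guard-inject₁ _≤ᵇ_ k j) lastTerm ⟨
  ∑ (row ∘ inject₁) + row (fromℕ n)
    ≡⟨ ∑-init-last row ⟨
  rowPart B (inject₁ k)
    ∎
  where
  row : Fin (suc n) → ℕ
  row j = guard (toℕ (inject₁ k) ≤ᵇ toℕ j) (entry B (inject₁ k) j)
  blockRow collapsedRow : Fin n → ℕ
  blockRow j = guard (toℕ k ≤ᵇ toℕ j) (block B k j)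
  collapsedRow j = guard (toℕ k ≤ᵇ toℕ j) (entry (collapse B) k j)

  k≤k : T (toℕ k ≤ᵇ toℕ k)
  k≤k = ≤⇒≤ᵇ (≤-refl {toℕ k})

  onDiagonal : collapsedRow k ≡ blockRow k + lastEntry B k
  onDiagonal = begin
    collapsedRow k                 ≡⟨ guard-T k≤k ⟩
    entry (collapse B) k k         ≡⟨ collapse-diag B k ⟩
    block B k k + lastEntry B k    ≡⟨ cong (_+ lastEntry B k) (guard-T k≤k) ⟨
    blockRow k + lastEntry B k     ∎

  offDiagonal : ∀ j → j ≢ k → collapsedRow j ≡ blockRow j
  offDiagonal j j≢k = guard-congT _ λ _ → collapse-off B (j≢k ∘ sym)

  lastTerm : row (fromℕ n) ≡ lastEntry B k
  lastTerm = guard-T (≤⇒≤ᵇ (<⇒≤ (inject₁<fromℕ k)))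

colPart-collapse : (B : Mat (suc n)) (k : Fin n) → colPart (collapse B) k ≡ colPart B (inject₁ k)
colPart-collapse {n} B k = sym (begin
  colPart B (inject₁ k)                ≡⟨ ∑-init-last col ⟩
  ∑ (col ∘ inject₁) + col (fromℕ n)    ≡⟨ cong₂ _+_ (∑-cong blockCol) lastTerm ⟩
  colPart (collapse B) k + 0           ≡⟨ +-identityʳ _ ⟩
  colPart (collapse B) k               ∎)
  where
  col : Fin (suc n) → ℕ
  col i = guard (toℕ i <ᵇ toℕ (inject₁ k)) (entry B i (inject₁ k))

  -- Above the diagonal, collapse B agrees with B.
  blockCol : ∀ i → col (inject₁ i) ≡ guard (toℕ i <ᵇ toℕ k) (entry (collapse B) i k)
  blockCol i = trans (guard-inject₁ _<ᵇ_ i k) (guard-congT _ λ i<k →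
    sym (collapse-off B λ i≡k → <-irrefl (cong toℕ i≡k) (<ᵇ⇒< (toℕ i) (toℕ k) i<k)))

  lastTerm : col (fromℕ n) ≡ 0
  lastTerm = guard-¬T λ n<k → <-asym (inject₁<fromℕ k) (<ᵇ⇒< _ _ n<k)

hook-collapse : (B : Mat (suc n)) (k : Fin n) → hook (collapse B) k ≡ hook B (inject₁ k)
hook-collapse B k = cong₂ (λ r s → + r - + s) (rowPart-collapse B k) (colPart-collapse B k)

hook-last : (B : Mat (suc n)) → hook B (fromℕ n) ≡ + corner B - + V.sum (lastcol B)
hook-last {n} B = cong₂ (λ r s → + r - + s) rowLast colLast
  where
  row col : Fin (suc n) → ℕ
  row j = guard (toℕ (fromℕ n) ≤ᵇ toℕ j) (entry B (fromℕ n) j)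
  col i = guard (toℕ i <ᵇ toℕ (fromℕ n)) (entry B i (fromℕ n))

  -- Row n is empty left of the corner (by the guard, not by upper triangularity).
  rowLast : rowPart B (fromℕ n) ≡ corner B
  rowLast = trans (∑-init-last row) (cong₂ _+_
    (∑-zero (row ∘ inject₁) λ j → guard-¬T λ n≤j → <⇒≱ (inject₁<fromℕ j) (≤ᵇ⇒≤ _ _ n≤j))
    (guard-T (≤⇒≤ᵇ (≤-refl {toℕ (fromℕ n)}))))

  colLast : colPart B (fromℕ n) ≡ V.sum (lastcol B)
  colLast = trans (∑-init-last col) (trans (cong₂ _+_
    (∑-cong {g = lastEntry B} λ i → guard-T (<⇒<ᵇ (inject₁<fromℕ i)))
    (guard-¬T λ n<n → <-irrefl refl (<ᵇ⇒< (toℕ (fromℕ n)) _ n<n))) (+-identityʳ _))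

⊖≡1⇔ : ∀ r s → (r ⊖ s ≡ + 1) ⇔ (r ≡ suc s)
⊖≡1⇔ r s = mk⇔ (forward r s) λ { refl → trans (⊖-≥ (n≤1+n s)) (cong +_ (m+n∸n≡m 1 s)) }
  where
  forward : ∀ r s → r ⊖ s ≡ + 1 → r ≡ suc s
  forward (suc r) zero refl = refl
  forward (suc r) (suc s) e = cong suc (forward r s (trans (sym ([1+m]⊖[1+n]≡m⊖n r s)) e))

hook-last≡1⇔ : (B : Mat (suc n)) → (hook B (fromℕ n) ≡ + 1) ⇔ (corner B ≡ suc (V.sum (lastcol B)))
hook-last≡1⇔ {n} B = mk⇔
  (λ h → Equivalence.to (⊖≡1⇔ r s) (trans (sym (trans (hook-last B) (m-n≡m⊖n r s))) h))
  (λ e → trans (trans (hook-last B) (m-n≡m⊖n r s)) (Equivalence.from (⊖≡1⇔ r s) e))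
  where
  r = corner B
  s = V.sum (lastcol B)

tesler-collapse : (B : Mat (suc n)) → Tesler B → Tesler (collapse B)
tesler-collapse B (upper , hooks) =
  upperCollapse , λ k → trans (hook-collapse B k) (hooks (inject₁ k))
  where
  upperCollapse : UpperTri (collapse B)
  upperCollapse i j j<i = trans (collapse-off B λ { refl → <-irrefl refl j<i })
    (upper (inject₁ i) (inject₁ j) (subst₂ _<_ (sym (toℕ-inject₁ j)) (sym (toℕ-inject₁ i)) j<i))

upper-extend : (A : Mat n) (c : Vec ℕ n) → UpperTri A → UpperTri (extend A c)
upper-extend A c upper i j j<i with view i | view j
... | ‵inject₁ i | ‵inject₁ j = trans (extend-block A c i j) (trans
        (onDiag-off _ (entry A) λ { refl → <-irrefl refl j<i })
        (upper i j (subst₂ _<_ (toℕ-inject₁ j) (toℕ-inject₁ i) j<i)))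
... | ‵inject₁ i | ‵fromℕ = ⊥-elim (<-asym j<i (inject₁<fromℕ i))
... | ‵fromℕ | ‵inject₁ j = extend-lastRow A c j
... | ‵fromℕ | ‵fromℕ = ⊥-elim (<-irrefl refl j<i)

tesler-extend : (A : Mat n) (c : Vec ℕ n) → Tesler A → Fits A c → Tesler (extend A c)
tesler-extend {n} A c (upper , hooks) fits = upper-extend A c upper , hooks′
  where
  hooks′ : (k : Fin (suc n)) → hook (extend A c) k ≡ + 1
  hooks′ k with view k
  ... | ‵inject₁ k = trans (sym (hook-collapse (extend A c) k))
                           (trans (cong (λ M → hook M k) (collapse-extend A c fits)) (hooks k))
  ... | ‵fromℕ = Equivalence.from (hook-last≡1⇔ (extend A c))
                   (trans (extend-corner A c) (cong (suc ∘ V.sum) (sym (lastcol-extend A c))))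

extend-collapse-tesler : (B : Mat (suc n)) → Tesler B → extend (collapse B) (lastcol B) ≡ B
extend-collapse-tesler {n} B (upper , hooks) = extend-collapse B
  (λ j → upper (fromℕ n) (inject₁ j) (inject₁<fromℕ j))
  (Equivalence.to (hook-last≡1⇔ B) (hooks (fromℕ n)))

splits : Mat n → List (Mat (suc n))
splits A = map (extend A) (boxes (diagonal A))

length-splits : (A : Mat n) → length (splits A) ≡ dpro A
length-splits A = trans (length-map (extend A) (boxes (diagonal A))) (length-boxes (diagonal A))

splits-unique : (A : Mat n) → Unique (splits A)
splits-unique A = Unique.map⁺ extend-injective (proj₁ (boxes-lists (diagonal A)))
  where
  extend-injective : ∀ {c c′} → extend A c ≡ extend A c′ → c ≡ c′
  extend-injective {c} {c′} e =
    trans (sym (lastcol-extend A c)) (trans (cong lastcol e) (lastcol-extend A c′))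

splits-shape : (A : Mat n) {B : Mat (suc n)} → B ∈ splits A → ∃ λ c → Fits A c × B ≡ extend A c
splits-shape A B∈ with c , c∈ , B≡ ← ∈-map⁻ (extend A) B∈ =
  c , Equivalence.to (proj₂ (boxes-lists (diagonal A)) c) c∈ , B≡

splits-fibre : (A : Mat n) {B : Mat (suc n)} → B ∈ splits A → collapse B ≡ A
splits-fibre A B∈ with c , fits , refl ← splits-shape A B∈ = collapse-extend A c fits

splits-tesler : (A : Mat n) {B : Mat (suc n)} → Tesler A → B ∈ splits A → Tesler B
splits-tesler A tA B∈ with c , fits , refl ← splits-shape A B∈ = tesler-extend A c tA fits

splits-complete : {B : Mat (suc n)} → Tesler B → B ∈ splits (collapse B)
splits-complete {B = B} tB = subst (_∈ splits (collapse B)) (extend-collapse-tesler B tB)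
  (∈-map⁺ (extend (collapse B)) (Equivalence.from (proj₂ (boxes-lists _) (lastcol B))
                                                  (lastcol-fits B)))

enumerates-suc : {L : List (Mat n)} → Enumerates n L → Enumerates (suc n) (concatMap splits L)
enumerates-suc = concatMap-lists collapse splits splits-unique (λ {A} → splits-fibre A)
  (λ {A} → splits-tesler A) splits-complete (λ {B} → tesler-collapse B)

enumerates-zero : Enumerates 0 L.[ [] ]
enumerates-zero =
  (All.[] AllPairs.∷ AllPairs.[]) , λ { [] → mk⇔ (λ _ → (λ ()) , (λ ())) (λ _ → here refl) }

tesler-enumeration : (n : ℕ) → ∃ λ (L : List (Mat n)) → Enumerates n L
tesler-enumeration zero = L.[ [] ] , enumerates-zero
tesler-enumeration (suc n) with L , enumL ← tesler-enumeration n =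
  concatMap splits L , enumerates-suc enumL

length-concatMap-splits : (L : List (Mat n)) → length (concatMap splits L) ≡ lsum (map dpro L)
length-concatMap-splits L.[] = refl
length-concatMap-splits (A L.∷ L) =
  trans (length-++ (splits A)) (cong₂ _+_ (length-splits A) (length-concatMap-splits L))

armstrong-at-1 : (L : List (Mat n)) → armstrong L 1 ≡ length L
armstrong-at-1 L.[] = refl
armstrong-at-1 (A L.∷ L) = cong₂ _+_ (^-zeroˡ (dpro A)) (armstrong-at-1 L)

armstrongDeriv-at-1 : (L : List (Mat n)) → armstrongDeriv L 1 ≡ lsum (map dpro L)
armstrongDeriv-at-1 L.[] = refl
armstrongDeriv-at-1 (A L.∷ L) =
  cong₂ _+_ (trans (cong (dpro A *_) (^-zeroˡ (dpro A ∸ 1))) (*-identityʳ (dpro A)))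
            (armstrongDeriv-at-1 L)

mainTheorem12 : (n : ℕ) → 1 ≤ n →
    (∃ λ (L : List (Mat n)) → Enumerates n L) ×
    ((L : List (Mat n)) (L' : List (Mat (suc n))) →
      Enumerates n L → Enumerates (suc n) L' →
      (armstrong L 1 ≡ length L) × (armstrongDeriv L 1 ≡ length L'))
mainTheorem12 n _ = tesler-enumeration n , λ L L′ enumL enumL′ → armstrong-at-1 L , (begin
  armstrongDeriv L 1           ≡⟨ armstrongDeriv-at-1 L ⟩
  lsum (map dpro L)            ≡⟨ length-concatMap-splits L ⟨
  length (concatMap splits L)  ≡⟨ lists-length (enumerates-suc enumL) enumL′ ⟩
  length L′                    ∎)
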